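{- For every integer $n\ge 18$ there exists a connected plane graph $G$ on $n$ vertices with maximum degree $\Delta(G)=4$ that has no facial $(P_3,P_3)$-WORM coloring.
   Context: All graphs are finite, planar, with a fixed plane embedding. A facial $k$-path (facial $P_k$) in a plane graph is a path on $k$ vertices whose vertices and edges appear consecutively on the boundary walk of some face. A set of vertices is rainbow under a vertex-coloring if its vertices receive pairwise distinct colors, and monochromatic if all its vertices receive the same color. A facial $(P_k,P_\ell)$-WORM coloring of a plane graph $G$ is a coloring of the vertices of $G$ (with any number of colors) such that $G$ contains no rainbow facial $P_k$ and no monochromatic facial $P_\ell$. -}

module Defs where

open import Data.Nat using (ℕ; zero; suc; _+_; _*_; _≤_; _<_; _≤ᵇ_)
open import Data.Fin using (Fin; toℕ; _≟_)
open import Data.List using (List; []; _∷_; map; upTo; length; filter)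
open import Data.Product using (Σ; ∃; _×_; _,_)
open import Function.Definitions using (Injective)
open import Relation.Binary.PropositionalEquality using (_≡_; _≢_)
open import Relation.Nullary using (¬_)
open import Data.Bool using (Bool; true; _∧_)

allB : ∀ {A : Set} → (A → Bool) → List A → Bool
allB p []       = true
allB p (x ∷ xs) = p x ∧ allB p xs

iter : ∀ {A : Set} → (A → A) → ℕ → A → A
iter f zero    x = x
iter f (suc k) x = f (iter f k x)

allDarts : (D : ℕ) → List (Fin D)
allDarts D = Data.List.allFin D
  where import Data.List

-- The orbit of d under f, listed as d, f d, ..., f^(D-1) d
-- (for a permutation of Fin D this is exactly the full orbit).
orbitList : ∀ {D} → (Fin D → Fin D) → Fin D → List (Fin D)
orbitList {D} f d = map (λ k → iter f k d) (upTo D)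

isOrbitRep : ∀ {D} → (Fin D → Fin D) → Fin D → Bool
isOrbitRep f d = allB (λ e → toℕ d ≤ᵇ toℕ e) (orbitList f d)

numOrbits : ∀ {D} → (Fin D → Fin D) → ℕ
numOrbits {D} f = length (filter (λ d → Data.Bool._≟_ (isOrbitRep f d) Data.Bool.true) (allDarts D))
  where import Data.Bool

-- A plane graph on n vertices, encoded combinatorially by a rotation system
-- (combinatorial map) of genus 0:
--   darts Fin D; each edge = pair of darts {d, α d}; tail d is the vertex at
--   which d starts; σ is the cyclic rotation of darts around each vertex
--   (given by the embedding); faces are the orbits of φ = σ ∘ α.
record PlaneGraph (n : ℕ) : Set where
  field
    D     : ℕ
    tail  : Fin D → Fin n
    α     : Fin D → Fin D
    σ     : Fin D → Fin D
    α-invol   : ∀ d → α (α d) ≡ d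
    α-nofix   : ∀ d → α d ≢ d
    σ-inj     : Injective _≡_ _≡_ σ
    σ-tail    : ∀ d → tail (σ d) ≡ tail d
    σ-trans   : ∀ d e → tail d ≡ tail e → ∃ λ k → iter σ k d ≡ e

  head : Fin D → Fin n
  head d = tail (α d)

  -- face-successor: the dart following d along its face boundary walk
  φ : Fin D → Fin D
  φ d = σ (α d)

  numFaces : ℕ
  numFaces = numOrbits φ

  degree : Fin n → ℕ
  degree v = length (filter (λ d → tail d ≟ v) (allDarts D))

open PlaneGraph public

Simple : ∀ {n} → PlaneGraph n → Set
Simple G = (∀ d → tail G d ≢ head G d)
         × (∀ d e → tail G d ≡ tail G e → head G d ≡ head G e → d ≡ e)

data Reach {n} (G : PlaneGraph n) : Fin n → Fin n → Set where
  here : ∀ {v} → Reach G v v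
  step : ∀ d {w} → Reach G (head G d) w → Reach G (tail G d) w

Connected : ∀ {n} → PlaneGraph n → Set
Connected G = ∀ u v → Reach G u v

-- Euler's formula V - E + F = 2 with E = D/2, i.e. the embedding is in the sphere
Planar : ∀ {n} → PlaneGraph n → Set
Planar {n} G = 2 * n + 2 * numFaces G ≡ D G + 4

MaxDegree : ∀ {n} → PlaneGraph n → ℕ → Set
MaxDegree G Δ = (∀ v → degree G v ≤ Δ) × (∃ λ v → degree G v ≡ Δ)

FacialP3 : ∀ {n} (G : PlaneGraph n) → Fin n → Fin n → Fin n → Set
FacialP3 G u v w = ∃ λ d → (tail G d ≡ u) × (head G d ≡ v) × (head G (φ G d) ≡ w)
                         × (u ≢ v) × (v ≢ w) × (u ≢ w)

Rainbow3 : ∀ {n} → (Fin n → ℕ) → Fin n → Fin n → Fin n → Set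
Rainbow3 c u v w = (c u ≢ c v) × (c v ≢ c w) × (c u ≢ c w)

Mono3 : ∀ {n} → (Fin n → ℕ) → Fin n → Fin n → Fin n → Set
Mono3 c u v w = (c u ≡ c v) × (c v ≡ c w)

-- facial (P3,P3)-WORM coloring (colors are natural numbers; any number of colors)
FacialWORM33 : ∀ {n} → PlaneGraph n → (Fin n → ℕ) → Set
FacialWORM33 G c = ∀ u v w → FacialP3 G u v w → ¬ Rainbow3 c u v w × ¬ Mono3 c u v w

-- The graph is a 9-vertex gadget (two triangles and six quadrangles) with a
-- pendant path on n - 9 further vertices hanging off its vertex 4, the hub.
-- The path only destroys the two facial P3s centred at the hub; seventeen other
-- facial P3s of the gadget already admit no colouring that is neither rainbow
-- nor monochromatic on each of them.  Since this property only depends on which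
-- vertices share a colour, it suffices to refute colourings f with f v ≤ v, and
-- a pruned exhaustive search does this by evaluation.
--
-- The construction works for every n ≥ 10.
module Submission where

open import Defs
open import Data.Nat using (ℕ; NonZero; zero; suc; _+_; _*_; _∸_; _≤_; _<_; _≥_; _≟_; _<?_; _≤ᵇ_; _<ᵇ_; _≡ᵇ_; z≤n; s≤s; z<s)
open import Data.Nat.Properties
  using (≤-refl; ≤-reflexive; ≤-trans; <-trans; <-≤-trans; <⇒≤; <⇒≢; <-irrefl; ≤-total; ≤-pred; ≮⇒≥; m≤n⇒m<n∨m≡n;
         suc-injective; +-suc; +-assoc; +-identityʳ; +-cancelˡ-≡; +-cancelˡ-<; +-monoʳ-<; +-mono-≤;
         m<n+m; m≤m+n; m≤n+m; n<1+n; m∸n≤m; m∸[m∸n]≡n; m+[n∸m]≡n; m+n∸m≡n; n∸n≡0; +-∸-assoc; ∸-monoʳ-≤;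
         ≡ᵇ⇒≡; ≡⇒≡ᵇ; ≤ᵇ⇒≤; ≤⇒≤ᵇ; <ᵇ⇒<; <⇒<ᵇ)
open import Data.Nat.DivMod using (_mod_; m<n⇒m%n≡m)
open import Data.Nat.Solver using (module +-*-Solver)
open import Data.Fin as Fin using (Fin; toℕ; fromℕ<) renaming (zero to fzero; suc to fsuc)
open import Data.Fin.Properties using (toℕ-injective; toℕ-fromℕ<; toℕ<n)
open import Data.Bool as Bool using (Bool; true; false; T; not; if_then_else_; _∧_; _∨_)
open import Data.Bool.Properties using (T-∨; T-∧; T-≡; ∧-zeroʳ)
open import Data.Bool.ListAction using (all; any)
open import Data.List using (List; []; _∷_; map; upTo; length; filter; tabulate)
open import Data.List.Relation.Unary.All as All using (All)
open import Data.List.Relation.Unary.All.Properties using (all⁺; map⁺)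
open import Data.List.Relation.Unary.Any as Any using (any?)
open import Data.List.Relation.Unary.Any.Properties using (any⁻)
open import Data.List.Membership.Propositional.Properties using (∈-upTo⁺)
open import Data.Product using (Σ; ∃; _×_; _,_; proj₁; proj₂)
open import Data.Sum using (_⊎_; inj₁; inj₂)
open import Data.Empty using (⊥; ⊥-elim)
open import Data.Unit using (tt)
open import Function using (_∘_; id)
open import Function.Bundles using (_⇔_; Equivalence; mk⇔)
open import Level using (0ℓ)
open import Relation.Nullary using (¬_; Dec; yes; no; does)
open import Relation.Nullary.Decidable using (¬?; _×-dec_; toWitness; isYes; True)
open import Relation.Unary using (Pred)
open import Relation.Binary.PropositionalEquality using (_≡_; _≢_; refl; sym; trans; cong; subst; module ≡-Reasoning)

open Equivalence using (to; from)

T-≡ᵇ : ∀ {a b} → T (a ≡ᵇ b) → a ≡ b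
T-≡ᵇ {a} {b} = ≡ᵇ⇒≡ a b

≡ᵇ-refl : ∀ a → (a ≡ᵇ a) ≡ true
≡ᵇ-refl a = T-≡ .to (≡⇒≡ᵇ a a refl)

T-≢ᵇ : ∀ {a b} → T (not (a ≡ᵇ b)) → a ≢ b
T-≢ᵇ {a} {b} differ refl = subst (T ∘ not) (≡ᵇ-refl a) differ

¬T⇒false : ∀ {b} → ¬ T b → b ≡ false
¬T⇒false {true}  ¬t = ⊥-elim (¬t tt)
¬T⇒false {false} _  = refl

T-not-∧ : ∀ {a b} → T (not (a ∧ b)) → T a → T b → ⊥
T-not-∧ {true} {true} ()

T-not : ∀ {a} → T (not a) → T a → ⊥
T-not {true} ()

T-<ᵇ : ∀ {a b} → T (a <ᵇ b) → a < b
T-<ᵇ {a} {b} = <ᵇ⇒< a b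

does-reflects : ∀ {A : Set} (a? : Dec A) {b : Bool} → (A → T b) → (T b → A) → does a? ≡ b
does-reflects (yes a) {true}  _     _        = refl
does-reflects (yes a) {false} sound _        = ⊥-elim (sound a)
does-reflects (no ¬a) {true}  _     complete = ⊥-elim (¬a (complete tt))
does-reflects (no ¬a) {false} _     _        = refl

Triple : Set
Triple = ℕ × ℕ × ℕ

Admissible : ℕ → ℕ → ℕ → Set
Admissible x y z = ¬ ((x ≢ y) × (y ≢ z) × (x ≢ z)) × ¬ ((x ≡ y) × (y ≡ z))

admissible? : ∀ x y z → Dec (Admissible x y z)
admissible? x y z = ¬? (¬? (x ≟ y) ×-dec ¬? (y ≟ z) ×-dec ¬? (x ≟ z)) ×-dec ¬? ((x ≟ y) ×-dec (y ≟ z))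

admissible-cong : ∀ {x y z x' y' z'} → x ≡ x' → y ≡ y' → z ≡ z' → Admissible x y z → Admissible x' y' z'
admissible-cong refl refl refl a = a

Respects : (ℕ → ℕ) → Triple → Set
Respects c (x , y , z) = Admissible (c x) (c y) (c z)

SamePattern : (ℕ → ℕ) → (ℕ → ℕ) → Set
SamePattern c c' = ∀ u v → (c u ≡ c v) ⇔ (c' u ≡ c' v)

respects-pattern : ∀ {c c'} → SamePattern c c' → ∀ {t} → Respects c t → Respects c' t
respects-pattern same {x , y , z} (notRainbow , notMono) =
    (λ (x≢y , y≢z , x≢z) → notRainbow (x≢y ∘ to (same x y) , y≢z ∘ to (same y z) , x≢z ∘ to (same x z)))
  , (λ (x≡y , y≡z) → notMono (from (same x y) x≡y , from (same y z) y≡z))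

-- least p n is the least i < n satisfying p (and n if there is none).
least : (ℕ → Bool) → ℕ → ℕ
least p zero    = zero
least p (suc n) = if p 0 then 0 else suc (least (p ∘ suc) n)

least-found : ∀ p {i n} → T (p i) → i < n → T (p (least p n)) × least p n ≤ i
least-found p {i} {suc n} pi i<n with p 0 in p0
... | true = subst T (sym p0) tt , z≤n
least-found p {zero}  {suc n} pi i<n | false = ⊥-elim (subst T p0 pi)
least-found p {suc i} {suc n} pi (s≤s i<n) | false =
  let (found , minimal) = least-found (p ∘ suc) pi i<n in found , s≤s minimal

least-agree : ∀ p {i m n} → T (p i) → i < m → i < n → least p m ≡ least p n
least-agree p {i} {suc m} {suc n} pi i<m i<n with p 0 in p0
... | true = refl
least-agree p {zero}  {suc m} {suc n} pi i<m i<n | false = ⊥-elim (subst T p0 pi)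
least-agree p {suc i} {suc m} {suc n} pi (s≤s i<m) (s≤s i<n) | false = cong suc (least-agree (p ∘ suc) pi i<m i<n)

canon : (ℕ → ℕ) → ℕ → ℕ
canon c v = least (λ u → c u ≡ᵇ c v) (suc v)

canon-≤ : ∀ (c : ℕ → ℕ) v → canon c v ≤ v
canon-≤ c v = proj₂ (least-found (λ u → c u ≡ᵇ c v) {v} (≡⇒≡ᵇ (c v) (c v) refl) ≤-refl)

canon-colour : ∀ (c : ℕ → ℕ) v → c (canon c v) ≡ c v
canon-colour c v = ≡ᵇ⇒≡ (c (canon c v)) (c v) (proj₁ (least-found (λ u → c u ≡ᵇ c v) {v} (≡⇒≡ᵇ (c v) (c v) refl) ≤-refl))

canon-pattern : ∀ (c : ℕ → ℕ) → SamePattern c (canon c)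
canon-pattern c u v = mk⇔ same-colour⇒same-canon same-canon⇒same-colour
  where
  open ≡-Reasoning
  same-colour⇒same-canon : c u ≡ c v → canon c u ≡ canon c v
  same-colour⇒same-canon cu≡cv with ≤-total u v
  ... | inj₁ u≤v = begin
      least (λ w → c w ≡ᵇ c u) (suc u)  ≡⟨ cong (λ a → least (λ w → c w ≡ᵇ a) (suc u)) cu≡cv ⟩
      least (λ w → c w ≡ᵇ c v) (suc u)  ≡⟨ least-agree (λ w → c w ≡ᵇ c v) {u} (≡⇒≡ᵇ (c u) (c v) cu≡cv) ≤-refl (s≤s u≤v) ⟩
      least (λ w → c w ≡ᵇ c v) (suc v)  ∎
  ... | inj₂ v≤u = begin
      least (λ w → c w ≡ᵇ c u) (suc u)  ≡⟨ least-agree (λ w → c w ≡ᵇ c u) {v} (≡⇒≡ᵇ (c v) (c u) (sym cu≡cv)) (s≤s v≤u) ≤-refl ⟩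
      least (λ w → c w ≡ᵇ c u) (suc v)  ≡⟨ cong (λ a → least (λ w → c w ≡ᵇ a) (suc v)) cu≡cv ⟩
      least (λ w → c w ≡ᵇ c v) (suc v)  ∎
  same-canon⇒same-colour : canon c u ≡ canon c v → c u ≡ c v
  same-canon⇒same-colour eq = begin
    c u              ≡⟨ sym (canon-colour c u) ⟩
    c (canon c u)    ≡⟨ cong c eq ⟩
    c (canon c v)    ≡⟨ canon-colour c v ⟩
    c v              ∎

_[_≔_] : (ℕ → ℕ) → ℕ → ℕ → ℕ → ℕ
(g [ n ≔ v ]) i = if i ≡ᵇ n then v else g i

update-same : ∀ g n v → (g [ n ≔ v ]) n ≡ v
update-same g n v rewrite ≡ᵇ-refl n = refl

update-other : ∀ g {n i} v → i ≢ n → (g [ n ≔ v ]) i ≡ g i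
update-other g {n} {i} v i≢n rewrite ¬T⇒false (i≢n ∘ T-≡ᵇ {i} {n}) = refl

-- g already decides the triple (all its vertices are below n) and breaks it.
Broken : ℕ → (ℕ → ℕ) → Triple → Set
Broken n g (x , y , z) = x < n × y < n × z < n × ¬ Admissible (g x) (g y) (g z)

broken? : ∀ n g t → Dec (Broken n g t)
broken? n g (x , y , z) = x <? n ×-dec y <? n ×-dec z <? n ×-dec ¬? (admissible? (g x) (g y) (g z))

-- Exhaustive search with pruning: refutes ts r n g holds when every colouring
-- that agrees with g below n and satisfies f i ≤ i for n ≤ i < r + n breaks a triple of ts.
refutes : List Triple → ℕ → ℕ → (ℕ → ℕ) → Bool
refutes ts zero    n g = isYes (any? (broken? n g) ts)
refutes ts (suc r) n g = isYes (any? (broken? n g) ts)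
                       ∨ all (λ v → refutes ts r (suc n) (g [ n ≔ v ])) (upTo (suc n))

agreeing-breaks : ∀ {n g f} → (∀ i → i < n → f i ≡ g i) → ∀ t → Respects f t → ¬ Broken n g t
agreeing-breaks agree (x , y , z) ok (x<n , y<n , z<n , bad) =
  bad (admissible-cong (agree x x<n) (agree y y<n) (agree z z<n) ok)

broken-sound : ∀ n g ts f → (∀ i → i < n → f i ≡ g i) → True (any? (broken? n g) ts) → ¬ All (Respects f) ts
broken-sound n g ts f agree found respects =
  let (ok , broken) = All.lookupAny respects (toWitness {a? = any? (broken? n g) ts} found) in agreeing-breaks agree _ ok broken

refutes-sound : ∀ ts r n g → T (refutes ts r n g) →
                ∀ f → (∀ i → i < n → f i ≡ g i) → (∀ i → n ≤ i → i < r + n → f i ≤ i) → ¬ All (Respects f) ts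
refutes-sound ts zero n g found f agree bounded = broken-sound n g ts f agree found
refutes-sound ts (suc r) n g refuted f agree bounded with to T-∨ refuted
... | inj₁ found = broken-sound n g ts f agree found
... | inj₂ every = refutes-sound ts r (suc n) (g [ n ≔ f n ]) branch f agree′ bounded′
  where
  branch : T (refutes ts r (suc n) (g [ n ≔ f n ]))
  branch = All.lookup (all⁺ _ (upTo (suc n)) every) (∈-upTo⁺ (s≤s (bounded n ≤-refl (m<n+m n z<s))))
  agree′ : ∀ i → i < suc n → f i ≡ (g [ n ≔ f n ]) i
  agree′ i (s≤s i≤n) with m≤n⇒m<n∨m≡n i≤n
  ... | inj₁ i<n  = trans (agree i i<n) (sym (update-other g (f n) (<⇒≢ i<n)))
  ... | inj₂ refl = sym (update-same g n (f n))
  bounded′ : ∀ i → suc n ≤ i → i < r + suc n → f i ≤ i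
  bounded′ i n<i i<r+n = bounded i (<⇒≤ n<i) (subst (i <_) (+-suc r n) i<r+n)

no-respecting-colouring : ∀ ts k → T (refutes ts k 0 (λ _ → 0)) → ∀ c → ¬ All (Respects c) ts
no-respecting-colouring ts k refuted c respects =
  refutes-sound ts k 0 (λ _ → 0) refuted (canon c) (λ _ ()) (λ i _ _ → canon-≤ c i)
    (All.map (respects-pattern (canon-pattern c)) respects)

count : (ℕ → Bool) → ℕ → ℕ
count b zero    = 0
count b (suc m) = (if b 0 then 1 else 0) + count (b ∘ suc) m

length-filter-tabulate : ∀ {A : Set} {P : Pred A 0ℓ} (P? : ∀ a → Dec (P a)) (b : ℕ → Bool) m (h : Fin m → A) →
                         (∀ i → does (P? (h i)) ≡ b (toℕ i)) → length (filter P? (tabulate h)) ≡ count b m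
length-filter-tabulate P? b zero    h agree = refl
length-filter-tabulate P? b (suc m) h agree with P? (h fzero) | agree fzero
... | yes _ | b0 rewrite sym b0 = cong suc (length-filter-tabulate P? (b ∘ suc) m (h ∘ fsuc) (agree ∘ fsuc))
... | no  _ | b0 rewrite sym b0 = length-filter-tabulate P? (b ∘ suc) m (h ∘ fsuc) (agree ∘ fsuc)

count-+ : ∀ b m k → count b (m + k) ≡ count b m + count (λ x → b (m + x)) k
count-+ b zero    k = refl
count-+ b (suc m) k = trans (cong (_ +_) (count-+ (b ∘ suc) m k)) (sym (+-assoc (if b 0 then 1 else 0) _ _))

count-none : ∀ b m → (∀ x → x < m → ¬ T (b x)) → count b m ≡ 0
count-none b zero    none = refl
count-none b (suc m) none with b 0 in b0
... | true  = ⊥-elim (none 0 z<s (subst T (sym b0) tt))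
... | false = count-none (b ∘ suc) m (λ x x<m → none (suc x) (s≤s x<m))

count-unique : ∀ b m → (∀ x y → x < m → y < m → T (b x) → T (b y) → x ≡ y) → count b m ≤ 1
count-unique b zero    unique = z≤n
count-unique b (suc m) unique with b 0 in b0
... | true  = s≤s (≤-reflexive (count-none (b ∘ suc) m others))
  where
  others : ∀ x → x < m → ¬ T (b (suc x))
  others x x<m bx with unique 0 (suc x) z<s (s≤s x<m) (subst T (sym b0) tt) bx
  ... | ()
... | false = count-unique (b ∘ suc) m (λ x y x<m y<m bx by → suc-injective (unique (suc x) (suc y) (s≤s x<m) (s≤s y<m) bx by))

certified : ∀ {n} (b : ℕ → Bool) → T (all b (upTo n)) → ∀ x → x < n → T (b x)
certified {n} b cert x x<n = All.lookup (all⁺ b (upTo n) cert) (∈-upTo⁺ x<n)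

iter-preserves : ∀ {A : Set} (f : A → A) (P : A → Set) → (∀ a → P a → P (f a)) → ∀ k {a} → P a → P (iter f k a)
iter-preserves f P preserves zero    pa = pa
iter-preserves f P preserves (suc k) pa = preserves _ (iter-preserves f P preserves k pa)

allB-map : ∀ {A B : Set} (p : B → Bool) (g : A → B) xs → (∀ a → T (p (g a))) → allB p (map g xs) ≡ true
allB-map p g []       holds = refl
allB-map p g (x ∷ xs) holds with p (g x) | holds x
... | true | _ = allB-map p g xs holds

rep-by-invariant : ∀ {D} (f : Fin D → Fin D) (P : Fin D → Set) d → P d → (∀ e → P e → P (f e)) →
                   (∀ e → P e → toℕ d ≤ toℕ e) → isOrbitRep f d ≡ true
rep-by-invariant {D} f P d pd closed least =
  allB-map (λ e → toℕ d ≤ᵇ toℕ e) (λ k → iter f k d) (upTo D)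
           (λ k → ≤⇒≤ᵇ (least _ (iter-preserves f P closed k pd)))

not-rep-by-descent : ∀ {D} (f : Fin D → Fin D) d → toℕ (f d) < toℕ d → isOrbitRep f d ≡ false
not-rep-by-descent {suc zero}    f fzero ()
not-rep-by-descent {suc (suc D)} f d fd<d with toℕ d ≤ᵇ toℕ (f d) in le
... | true  = ⊥-elim (<-irrefl refl (<-≤-trans fd<d (≤ᵇ⇒≤ _ _ (subst T (sym le) tt))))
... | false = ∧-zeroʳ (toℕ d ≤ᵇ toℕ d)

numOrbits-count : ∀ {D} (f : Fin D → Fin D) (rep : ℕ → Bool) → (∀ d → isOrbitRep f d ≡ rep (toℕ d)) → numOrbits f ≡ count rep D
numOrbits-count {D} f rep decides =
  length-filter-tabulate (λ d → isOrbitRep f d Bool.≟ true) rep D id (λ d → trans (does-≟-true _) (decides d))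
  where
  does-≟-true : ∀ b → does (b Bool.≟ true) ≡ b
  does-≟-true true  = refl
  does-≟-true false = refl

-- Reachability is transitive and, since every edge has two darts, symmetric.
reach-trans : ∀ {n} (G : PlaneGraph n) {u v w} → Reach G u v → Reach G v w → Reach G u w
reach-trans G here          r = r
reach-trans G (step d rest) r = step d (reach-trans G rest r)

reach-back : ∀ {n} (G : PlaneGraph n) d → Reach G (head G d) (tail G d)
reach-back G d = step (α G d) (subst (λ e → Reach G (tail G e) (tail G d)) (sym (α-invol G d)) here)

reach-sym : ∀ {n} (G : PlaneGraph n) {u v} → Reach G u v → Reach G v u
reach-sym G here          = here
reach-sym G (step d rest) = reach-trans G (reach-sym G rest) (reach-back G d)

-- A plane graph presented by tables on natural numbers: darts are 0 … D-1,
-- vertices 0 … n-1, and every axiom of PlaneGraph is required on darts only.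
record Presentation (n D : ℕ) : Set where
  field
    tailᴺ αᴺ σᴺ   : ℕ → ℕ
    tail-bound    : ∀ x → x < D → tailᴺ x < n
    α-bound       : ∀ x → x < D → αᴺ x < D
    σ-bound       : ∀ x → x < D → σᴺ x < D
    α-involutive  : ∀ x → x < D → αᴺ (αᴺ x) ≡ x
    α-fixfree     : ∀ x → x < D → αᴺ x ≢ x
    σ-injective   : ∀ x y → x < D → y < D → σᴺ x ≡ σᴺ y → x ≡ y
    σ-keeps-tail  : ∀ x → x < D → tailᴺ (σᴺ x) ≡ tailᴺ x
    σ-transitive  : ∀ x y → x < D → y < D → tailᴺ x ≡ tailᴺ y → ∃ λ k → iter σᴺ k x ≡ y

  headᴺ : ℕ → ℕ
  headᴺ x = tailᴺ (αᴺ x)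

  φᴺ : ℕ → ℕ
  φᴺ x = σᴺ (αᴺ x)

module Presented {n D : ℕ} (P : Presentation n D) where
  open Presentation P

  private
    onDarts : (f : ℕ → ℕ) → (∀ x → x < D → f x < D) → Fin D → Fin D
    onDarts f bound d = fromℕ< (bound (toℕ d) (toℕ<n d))

    toℕ-iter : ∀ (f : Fin D → Fin D) (fᴺ : ℕ → ℕ) → (∀ d → toℕ (f d) ≡ fᴺ (toℕ d)) →
               ∀ k d → toℕ (iter f k d) ≡ iter fᴺ k (toℕ d)
    toℕ-iter f fᴺ commutes zero    d = refl
    toℕ-iter f fᴺ commutes (suc k) d = trans (commutes (iter f k d)) (cong fᴺ (toℕ-iter f fᴺ commutes k d))

  graph : PlaneGraph n
  graph = record
    { D = D
    ; tail = λ d → fromℕ< (tail-bound (toℕ d) (toℕ<n d))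
    ; α = onDarts αᴺ α-bound
    ; σ = onDarts σᴺ σ-bound
    ; α-invol = λ d → toℕ-injective (trans (toℕ-fromℕ< _) (trans (cong αᴺ (toℕ-fromℕ< _)) (α-involutive _ (toℕ<n d))))
    ; α-nofix = λ d eq → α-fixfree _ (toℕ<n d) (trans (sym (toℕ-fromℕ< _)) (cong toℕ eq))
    ; σ-inj = λ {d} {e} eq → toℕ-injective (σ-injective _ _ (toℕ<n d) (toℕ<n e)
                (trans (sym (toℕ-fromℕ< _)) (trans (cong toℕ eq) (toℕ-fromℕ< _))))
    ; σ-tail = λ d → toℕ-injective (trans (toℕ-fromℕ< _) (trans (cong tailᴺ (toℕ-fromℕ< _))
                (trans (σ-keeps-tail _ (toℕ<n d)) (sym (toℕ-fromℕ< _)))))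
    ; σ-trans = λ d e same → let (k , reaches) = σ-transitive _ _ (toℕ<n d) (toℕ<n e)
                                   (trans (sym (toℕ-fromℕ< _)) (trans (cong toℕ same) (toℕ-fromℕ< _)))
                              in k , toℕ-injective (trans (toℕ-iter _ σᴺ (λ _ → toℕ-fromℕ< _) k d) reaches)
    }

  toℕ-tail : ∀ d → toℕ (tail graph d) ≡ tailᴺ (toℕ d)
  toℕ-tail d = toℕ-fromℕ< _

  toℕ-α : ∀ d → toℕ (α graph d) ≡ αᴺ (toℕ d)
  toℕ-α d = toℕ-fromℕ< _

  toℕ-head : ∀ d → toℕ (head graph d) ≡ headᴺ (toℕ d)
  toℕ-head d = trans (toℕ-tail (α graph d)) (cong tailᴺ (toℕ-α d))

  toℕ-φ : ∀ d → toℕ (φ graph d) ≡ φᴺ (toℕ d)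
  toℕ-φ d = trans (toℕ-fromℕ< _) (cong σᴺ (toℕ-α d))

  dart : ∀ x → x < D → Fin D
  dart x x<D = fromℕ< x<D

  toℕ-dart : ∀ x (x<D : x < D) → toℕ (dart x x<D) ≡ x
  toℕ-dart x x<D = toℕ-fromℕ< x<D

  tail-at : ∀ x (x<D : x < D) → toℕ (tail graph (dart x x<D)) ≡ tailᴺ x
  tail-at x x<D = trans (toℕ-tail _) (cong tailᴺ (toℕ-dart x x<D))

  head-at : ∀ x (x<D : x < D) → toℕ (head graph (dart x x<D)) ≡ headᴺ x
  head-at x x<D = trans (toℕ-head _) (cong headᴺ (toℕ-dart x x<D))

  next-at : ∀ x (x<D : x < D) → toℕ (head graph (φ graph (dart x x<D))) ≡ headᴺ (φᴺ x)
  next-at x x<D = trans (toℕ-head _) (cong headᴺ (trans (toℕ-φ _) (cong φᴺ (toℕ-dart x x<D))))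

  -- Counting faces: if the darts not flagged by start are preceded by their face
  -- successor, and every flagged dart s is the least element of a φ-closed set
  -- of darts, then the flagged darts are exactly the face representatives.
  -- (Working with abstract tables here keeps orbits from ever being unfolded.)
  count-faces : (start : ℕ → Bool) → (∀ x → x < D → ¬ T (start x) → φᴺ x < x) →
                (∀ s → s < D → T (start s) → Σ (ℕ → Set) λ Face →
                   Face s × (∀ e → e < D → Face e → Face (φᴺ e)) × (∀ e → Face e → s ≤ e)) →
                numFaces graph ≡ count start D
  count-faces start descends faces = numOrbits-count (φ graph) start (λ d → classify d (start (toℕ d)) refl)
    where
    classify : ∀ d b → start (toℕ d) ≡ b → isOrbitRep (φ graph) d ≡ b
    classify d false not-start = not-rep-by-descent (φ graph) d
      (subst (_< toℕ d) (sym (toℕ-φ d)) (descends (toℕ d) (toℕ<n d) (λ started → subst T not-start started)))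
    classify d true started =
      let (Face , own , closed , least) = faces (toℕ d) (toℕ<n d) (subst T (sym started) tt)
      in rep-by-invariant (φ graph) (Face ∘ toℕ) d own
           (λ e in-face → subst Face (sym (toℕ-φ e)) (closed (toℕ e) (toℕ<n e) in-face)) (λ e → least (toℕ e))

  data Linked : ℕ → ℕ → Set where
    here : ∀ {a} → Linked a a
    step : ∀ x → x < D → ∀ {b} → Linked (headᴺ x) b → Linked (tailᴺ x) b

  linked⇒reach : ∀ {a b} → Linked a b → ∀ u v → toℕ u ≡ a → toℕ v ≡ b → Reach graph u v
  linked⇒reach here u v u≡a v≡a = subst (Reach graph u) (toℕ-injective (trans u≡a (sym v≡a))) here
  linked⇒reach (step x x<D rest) u v u≡tail v≡b =
    subst (λ w → Reach graph w v) (toℕ-injective (trans (tail-at x x<D) (sym u≡tail)))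
      (step (dart x x<D) (linked⇒reach rest (head graph (dart x x<D)) v (head-at x x<D) v≡b))

  connected-via : ∀ hub → (∀ a → a < n → Linked a (toℕ hub)) → Connected graph
  connected-via hub linked u v = reach-trans graph (toHub u) (reach-sym graph (toHub v))
    where
    toHub : ∀ w → Reach graph w hub
    toHub w = linked⇒reach (linked (toℕ w) (toℕ<n w)) w hub refl refl

  simple-from-tables : (∀ x → x < D → tailᴺ x ≢ headᴺ x) →
                       (∀ x y → x < D → y < D → tailᴺ x ≡ tailᴺ y → headᴺ x ≡ headᴺ y → x ≡ y) → Simple graph
  simple-from-tables loopless unique =
      (λ d loop → loopless _ (toℕ<n d) (trans (sym (toℕ-tail d)) (trans (cong toℕ loop) (toℕ-head d))))
    , (λ d e sameTail sameHead → toℕ-injective (unique _ _ (toℕ<n d) (toℕ<n e)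
          (trans (sym (toℕ-tail d)) (trans (cong toℕ sameTail) (toℕ-tail e)))
          (trans (sym (toℕ-head d)) (trans (cong toℕ sameHead) (toℕ-head e)))))

  degree-count : ∀ v → degree graph v ≡ count (λ x → tailᴺ x ≡ᵇ toℕ v) D
  degree-count v = length-filter-tabulate (λ d → tail graph d Fin.≟ v) _ D id
    (λ d → does-reflects (tail graph d Fin.≟ v)
             (λ eq → ≡⇒≡ᵇ _ _ (trans (sym (toℕ-tail d)) (cong toℕ eq)))
             (λ eq → toℕ-injective (trans (toℕ-tail d) (≡ᵇ⇒≡ _ _ eq))))

  facial : ∀ x (x<D : x < D) → let d = dart x x<D in
           tailᴺ x ≢ headᴺ x → headᴺ x ≢ headᴺ (φᴺ x) → tailᴺ x ≢ headᴺ (φᴺ x) →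
           FacialP3 graph (tail graph d) (head graph d) (head graph (φ graph d))
  facial x x<D ≢₁ ≢₂ ≢₃ = dart x x<D , refl , refl , refl ,
    distinct ≢₁ (tail-at x x<D) (head-at x x<D) , distinct ≢₂ (head-at x x<D) (next-at x x<D) ,
    distinct ≢₃ (tail-at x x<D) (next-at x x<D)
    where
    distinct : ∀ {a b} {u v : Fin n} → a ≢ b → toℕ u ≡ a → toℕ v ≡ b → u ≢ v
    distinct a≢b refl refl u≡v = a≢b (cong toℕ u≡v)

  colourOf : {{_ : NonZero n}} → (Fin n → ℕ) → ℕ → ℕ
  colourOf c a = c (a mod n)

  worm-respects : {{_ : NonZero n}} → ∀ c → FacialWORM33 graph c → ∀ x → x < D →
                  tailᴺ x ≢ headᴺ x → headᴺ x ≢ headᴺ (φᴺ x) → tailᴺ x ≢ headᴺ (φᴺ x) →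
                  Respects (colourOf c) (tailᴺ x , headᴺ x , headᴺ (φᴺ x))
  worm-respects c worm x x<D ≢₁ ≢₂ ≢₃ =
    admissible-cong (recolour (tail-at x x<D)) (recolour (head-at x x<D)) (recolour (next-at x x<D))
      (worm _ _ _ (facial x x<D ≢₁ ≢₂ ≢₃))
    where
    recolour : ∀ {u a} → toℕ u ≡ a → c u ≡ colourOf c a
    recolour {u} refl = cong c (toℕ-injective (sym (trans (toℕ-fromℕ< _) (m<n⇒m%n≡m (toℕ<n u)))))

-- Entry i of a table (0 beyond its end).
entry : List ℕ → ℕ → ℕ
entry []       i       = 0
entry (a ∷ as) zero    = a
entry (a ∷ as) (suc i) = entry as i

-- The gadget: a plane graph on vertices 0 … 8 with darts 0 … 29, given by the
-- tables of its edge involution α₀, rotation σ₀ (with inverse σ₀⁻¹) and tails.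
-- Its faces are the triangles 2 0 8 and 2 1 3 and the quadrangles
-- 6 0 2 3, 8 0 5 7, 7 1 2 8, 3 1 7 6, 5 4 6 7 and 6 4 5 0 (the outer face);
-- vertex 4, of degree 2, is the hub where the pendant path is attached.
α₀ : ℕ → ℕ
α₀ = entry (6 ∷ 16 ∷ 7 ∷ 27 ∷ 19 ∷ 12 ∷ 0 ∷ 2 ∷ 15 ∷ 23 ∷ 28 ∷ 17 ∷ 5 ∷ 18 ∷ 21 ∷ 8 ∷ 1 ∷ 11 ∷ 13 ∷ 4 ∷ 24 ∷ 14 ∷ 29 ∷ 9 ∷ 20 ∷ 26 ∷ 25 ∷ 3 ∷ 10 ∷ 22 ∷ [])

σ₀ : ℕ → ℕ
σ₀ = entry (5 ∷ 15 ∷ 10 ∷ 26 ∷ 18 ∷ 11 ∷ 2 ∷ 1 ∷ 14 ∷ 22 ∷ 27 ∷ 16 ∷ 4 ∷ 21 ∷ 20 ∷ 7 ∷ 0 ∷ 13 ∷ 12 ∷ 3 ∷ 23 ∷ 17 ∷ 28 ∷ 8 ∷ 19 ∷ 29 ∷ 24 ∷ 6 ∷ 9 ∷ 25 ∷ [])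

σ₀⁻¹ : ℕ → ℕ
σ₀⁻¹ = entry (16 ∷ 7 ∷ 6 ∷ 19 ∷ 12 ∷ 0 ∷ 27 ∷ 15 ∷ 23 ∷ 28 ∷ 2 ∷ 5 ∷ 18 ∷ 17 ∷ 8 ∷ 1 ∷ 11 ∷ 21 ∷ 4 ∷ 24 ∷ 14 ∷ 13 ∷ 9 ∷ 20 ∷ 26 ∷ 29 ∷ 3 ∷ 10 ∷ 22 ∷ 25 ∷ [])

tail₀ : ℕ → ℕ
tail₀ = entry (2 ∷ 8 ∷ 0 ∷ 6 ∷ 3 ∷ 2 ∷ 0 ∷ 8 ∷ 7 ∷ 5 ∷ 0 ∷ 2 ∷ 3 ∷ 1 ∷ 7 ∷ 8 ∷ 2 ∷ 1 ∷ 3 ∷ 6 ∷ 7 ∷ 1 ∷ 5 ∷ 7 ∷ 6 ∷ 4 ∷ 6 ∷ 0 ∷ 5 ∷ 4 ∷ [])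

-- Faces are the intervals of darts [s, faceEnd₀ s) for the face starts s
-- (faceEnd₀ s = 0 when s starts no face); 26 starts the outer face.
faceEnd₀ : ℕ → ℕ
faceEnd₀ = entry (3 ∷ 0 ∷ 0 ∷ 7 ∷ 0 ∷ 0 ∷ 0 ∷ 11 ∷ 0 ∷ 0 ∷ 0 ∷ 14 ∷ 0 ∷ 0 ∷ 18 ∷ 0 ∷ 0 ∷ 0 ∷ 22 ∷ 0 ∷ 0 ∷ 0 ∷ 26 ∷ 0 ∷ 0 ∷ 0 ∷ 30 ∷ 0 ∷ 0 ∷ 0 ∷ [])

-- Path edge j joins inner j to 9 + j: the first edge starts at the hub 4.
inner : ℕ → ℕ
inner zero    = 4
inner (suc j) = 9 + j

inner-< : ∀ j → inner j < 9 + j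
inner-< zero    = s≤s (s≤s (s≤s (s≤s (s≤s z≤n))))
inner-< (suc j) = n<1+n (9 + j)

inner-injective : ∀ {j k} → inner j ≡ inner k → j ≡ k
inner-injective {zero}  {zero}  _  = refl
inner-injective {suc j} {suc k} eq = cong suc (+-cancelˡ-≡ 9 j k eq)

Uncolourable : ℕ → Set
Uncolourable n = Σ (PlaneGraph n) λ G → Simple G × Connected G × Planar G × MaxDegree G 4
                 × ¬ (Σ (Fin n → ℕ) λ c → FacialWORM33 G c)

-- The gadget with a pendant path on p = q + 1 further vertices 9 … 8 + p,
-- hanging off the hub 4.  Darts 0 … 29 are those of the gadget; the 2p path
-- darts 30 + y are numbered so that walking around the path decreases them:
-- 30 + y with y < p is the inward dart of edge y (from 9 + y to inner y), and
-- 30 + mirror j is the outward dart of edge j.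
module PendantPath (q : ℕ) where
  p : ℕ
  p = suc q

  nV : ℕ
  nV = 9 + p

  nD : ℕ
  nD = 30 + (p + p)

  -- mirror reverses the block of 2p path darts.
  mirror : ℕ → ℕ
  mirror y = (p + q) ∸ y

  hubExit : ℕ
  hubExit = 30 + mirror 0

  pathTail : ℕ → ℕ
  pathTail y = if y <ᵇ p then 9 + y else inner (mirror y)

  tailᴺ αᴺ σᴺ : ℕ → ℕ
  tailᴺ x = if x <ᵇ 30 then tail₀ x else pathTail (x ∸ 30)
  αᴺ x = if x <ᵇ 30 then α₀ x else 30 + mirror (x ∸ 30)
  -- around the hub the path is spliced in between the gadget darts 25 and 29
  σᴺ x = if x <ᵇ 30 then (if x ≡ᵇ 25 then hubExit else σ₀ x) else 29 + mirror (x ∸ 30)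

  on-path : ∀ {j} → j ≤ q → j ≤ p + q
  on-path j≤q = ≤-trans j≤q (m≤n+m q p)

  mirror-involutive : ∀ {y} → y ≤ p + q → mirror (mirror y) ≡ y
  mirror-involutive y≤ = m∸[m∸n]≡n y≤

  mirror-≤ : ∀ y → mirror y ≤ p + q
  mirror-≤ y = m∸n≤m (p + q) y

  mirror-inward : ∀ {j} → j ≤ q → mirror j ≡ p + (q ∸ j)
  mirror-inward j≤q = +-∸-assoc p j≤q

  inward<outward : ∀ {j} → j ≤ q → j < mirror j
  inward<outward {j} j≤q = subst (j <_) (sym (mirror-inward j≤q)) (≤-trans (s≤s j≤q) (m≤m+n p (q ∸ j)))

  path-bound : ∀ {y} → y < p + p → y ≤ p + q
  path-bound {y} y< = ≤-pred (subst (y <_) (+-suc p q) y<)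

  data PathDart : ℕ → Set where
    inward  : ∀ j → j ≤ q → PathDart j
    outward : ∀ j → j ≤ q → PathDart (mirror j)

  pathDart : ∀ y → y < p + p → PathDart y
  pathDart y y< with y <? p
  ... | yes y<p = inward y (≤-pred y<p)
  ... | no  y≮p = subst PathDart (mirror-involutive (path-bound y<)) (outward (mirror y) small)
    where
    small : mirror y ≤ q
    small = subst (mirror y ≤_) (m+n∸m≡n p q) (∸-monoʳ-≤ (p + q) (≮⇒≥ y≮p))

  path-offset : ∀ {y} → PathDart y → y ≤ p + q
  path-offset (inward  j j≤q) = on-path j≤q
  path-offset (outward j _)   = mirror-≤ j

  data DartView : ℕ → Set where
    gadget : ∀ x → x < 30 → DartView x
    path   : ∀ {y} → PathDart y → DartView (30 + y)

  view : ∀ x → x < nD → DartView x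
  view x x<D with x <? 30
  ... | yes x<30 = gadget x x<30
  ... | no  x≮30 = subst DartView (m+[n∸m]≡n 30≤x) (path (pathDart (x ∸ 30) (+-cancelˡ-< 30 _ _ bound)))
    where
    30≤x : 30 ≤ x
    30≤x = ≮⇒≥ x≮30
    bound : 30 + (x ∸ 30) < 30 + (p + p)
    bound = subst (_< nD) (sym (m+[n∸m]≡n 30≤x)) x<D

  -- (These agree with headᴺ and φᴺ of the presentation built below.)
  headᴺ φᴺ : ℕ → ℕ
  headᴺ x = tailᴺ (αᴺ x)
  φᴺ x = σᴺ (αᴺ x)

  tail-inward : ∀ {j} → j ≤ q → tailᴺ (30 + j) ≡ 9 + j
  tail-inward {j} j≤q = cong (λ b → if b then 9 + j else inner (mirror j)) (T-≡ .to (<⇒<ᵇ (s≤s j≤q)))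

  tail-outward : ∀ {j} → j ≤ q → tailᴺ (30 + mirror j) ≡ inner j
  tail-outward {j} j≤q = trans (cong (λ b → if b then 9 + mirror j else inner (mirror (mirror j))) not-inward)
                               (cong inner (mirror-involutive (on-path j≤q)))
    where
    not-inward : (mirror j <ᵇ p) ≡ false
    not-inward = ¬T⇒false (λ lt → <-irrefl refl (<-≤-trans (T-<ᵇ lt) (subst (p ≤_) (sym (mirror-inward j≤q)) (m≤m+n p (q ∸ j)))))

  head-inward : ∀ {j} → j ≤ q → headᴺ (30 + j) ≡ inner j
  head-inward = tail-outward

  head-outward : ∀ {j} → j ≤ q → headᴺ (30 + mirror j) ≡ 9 + j
  head-outward {j} j≤q = trans (cong (λ y → tailᴺ (30 + y)) (mirror-involutive (on-path j≤q))) (tail-inward j≤q)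

  σ-inward : ∀ {j} → j < q → σᴺ (30 + j) ≡ 30 + mirror (suc j)
  σ-inward {j} j<q = cong (29 +_) (trans (mirror-inward (<⇒≤ j<q))
                       (trans (cong (p +_) (+-∸-assoc 1 j<q)) (trans (+-suc p (q ∸ suc j)) (cong suc (sym (mirror-inward j<q))))))

  σ-outward : ∀ {j} → j < q → σᴺ (30 + mirror (suc j)) ≡ 30 + j
  σ-outward {j} j<q = cong (29 +_) (mirror-involutive (on-path j<q))

  σ-leaf : σᴺ (30 + q) ≡ 30 + q
  σ-leaf = cong (29 +_) (trans (mirror-inward ≤-refl) (trans (cong (p +_) (n∸n≡0 q)) (+-identityʳ p)))

  σ-hubExit : σᴺ hubExit ≡ 29
  σ-hubExit = cong (29 +_) (mirror-involutive z≤n)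

  φ-path : ∀ {y} → y ≤ p + q → φᴺ (30 + y) ≡ 29 + y
  φ-path y≤ = cong (29 +_) (mirror-involutive y≤)

  gadget-check : ∀ (b : ℕ → Bool) → T (all b (upTo 30)) → ∀ x → x < 30 → T (b x)
  gadget-check b = certified {30} b

  off-hub-check : ∀ (b : ℕ → Bool) → T (all (λ x → (x ≡ᵇ 25) ∨ b x) (upTo 30)) → ∀ x → x < 30 → x ≢ 25 → T (b x)
  off-hub-check b cert x x<30 x≢25 with to T-∨ (gadget-check (λ x → (x ≡ᵇ 25) ∨ b x) cert x x<30)
  ... | inj₁ x≡25 = ⊥-elim (x≢25 (T-≡ᵇ x≡25))
  ... | inj₂ bx   = bx

  pair-check : ∀ (b : ℕ → ℕ → Bool) → T (all (λ x → all (b x) (upTo 30)) (upTo 30)) → ∀ x y → x < 30 → y < 30 → T (b x y)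
  pair-check b cert x y x<30 y<30 = gadget-check (b x) (gadget-check (λ x → all (b x) (upTo 30)) cert x x<30) y y<30

  gadget-α-bound : ∀ x → x < 30 → αᴺ x < 30
  gadget-α-bound x x<30 = T-<ᵇ (gadget-check (λ x → αᴺ x <ᵇ 30) tt x x<30)

  gadget-α-involutive : ∀ x → x < 30 → αᴺ (αᴺ x) ≡ x
  gadget-α-involutive x x<30 = T-≡ᵇ (gadget-check (λ x → αᴺ (αᴺ x) ≡ᵇ x) tt x x<30)

  gadget-α-fixfree : ∀ x → x < 30 → αᴺ x ≢ x
  gadget-α-fixfree x x<30 = T-≢ᵇ (gadget-check (λ x → not (αᴺ x ≡ᵇ x)) tt x x<30)

  gadget-tail-bound : ∀ x → x < 30 → tailᴺ x < 9
  gadget-tail-bound x x<30 = T-<ᵇ (gadget-check (λ x → tailᴺ x <ᵇ 9) tt x x<30)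

  gadget-σ-bound : ∀ x → x < 30 → x ≢ 25 → σᴺ x < 30
  gadget-σ-bound x x<30 x≢25 = T-<ᵇ (off-hub-check (λ x → σᴺ x <ᵇ 30) tt x x<30 x≢25)

  gadget-σ-tail : ∀ x → x < 30 → x ≢ 25 → tailᴺ (σᴺ x) ≡ tailᴺ x
  gadget-σ-tail x x<30 x≢25 = T-≡ᵇ (off-hub-check (λ x → tailᴺ (σᴺ x) ≡ᵇ tailᴺ x) tt x x<30 x≢25)

  gadget-at-hub : ∀ x → x < 30 → tailᴺ x ≡ 4 → x ≡ 25 ⊎ x ≡ 29
  gadget-at-hub x x<30 at-hub with to T-∨ (gadget-check (λ x → not (tailᴺ x ≡ᵇ 4) ∨ ((x ≡ᵇ 25) ∨ (x ≡ᵇ 29))) tt x x<30)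
  ... | inj₁ off-hub = ⊥-elim (T-≢ᵇ off-hub at-hub)
  ... | inj₂ at-25-29 with to T-∨ at-25-29
  ...   | inj₁ x≡25 = inj₁ (T-≡ᵇ x≡25)
  ...   | inj₂ x≡29 = inj₂ (T-≡ᵇ x≡29)

  gadget-dart : ∀ {x} → x < 30 → x < nD
  gadget-dart x<30 = <-≤-trans x<30 (m≤m+n 30 (p + p))

  path-dart : ∀ {y} → y ≤ p + q → 30 + y < nD
  path-dart {y} y≤ = +-monoʳ-< 30 (subst (y <_) (sym (+-suc p q)) (s≤s y≤))

  gadget-vertex : ∀ {a} → a < 9 → a < nV
  gadget-vertex a<9 = <-≤-trans a<9 (m≤m+n 9 p)

  path-vertex : ∀ {j} → j ≤ q → 9 + j < nV
  path-vertex j≤q = +-monoʳ-< 9 (s≤s j≤q)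

  inner-vertex : ∀ {j} → j ≤ q → inner j < nV
  inner-vertex {j} j≤q = <-trans (inner-< j) (path-vertex j≤q)

  tail-bound : ∀ x → x < nD → tailᴺ x < nV
  tail-bound x x<D with view x x<D
  ... | gadget x x<30         = gadget-vertex (gadget-tail-bound x x<30)
  ... | path (inward  j j≤q) = subst (_< nV) (sym (tail-inward j≤q)) (path-vertex j≤q)
  ... | path (outward j j≤q) = subst (_< nV) (sym (tail-outward j≤q)) (inner-vertex j≤q)

  α-bound : ∀ x → x < nD → αᴺ x < nD
  α-bound x x<D with view x x<D
  ... | gadget x x<30 = gadget-dart (gadget-α-bound x x<30)
  ... | path {y} _     = path-dart (mirror-≤ y)

  σ-bound : ∀ x → x < nD → σᴺ x < nD
  σ-bound x x<D with view x x<D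
  ... | path {y} _ = <-trans (n<1+n (29 + mirror y)) (path-dart (mirror-≤ y))
  ... | gadget x x<30 with x ≟ 25
  ...   | yes refl  = path-dart (mirror-≤ 0)
  ...   | no  x≢25  = gadget-dart (gadget-σ-bound x x<30 x≢25)

  α-involutive : ∀ x → x < nD → αᴺ (αᴺ x) ≡ x
  α-involutive x x<D with view x x<D
  ... | gadget x x<30 = gadget-α-involutive x x<30
  ... | path py        = cong (30 +_) (mirror-involutive (path-offset py))

  α-fixfree : ∀ x → x < nD → αᴺ x ≢ x
  α-fixfree x x<D with view x x<D
  ... | gadget x x<30         = gadget-α-fixfree x x<30
  ... | path (inward  j j≤q) = λ eq → <-irrefl (sym (+-cancelˡ-≡ 30 _ _ eq)) (inward<outward j≤q)
  ... | path (outward j j≤q) = λ eq → <-irrefl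
          (trans (sym (mirror-involutive (on-path j≤q))) (+-cancelˡ-≡ 30 _ _ eq)) (inward<outward j≤q)

  -- A left inverse of the rotation: on path darts other than hubExit the rotation is an involution.
  σ⁻¹ᴺ : ℕ → ℕ
  σ⁻¹ᴺ x = if x <ᵇ 30 then (if x ≡ᵇ 29 then hubExit else σ₀⁻¹ x) else (if x ≡ᵇ hubExit then 25 else σᴺ x)

  σ-retraction-path : ∀ y → y ≤ p + q → σ⁻¹ᴺ (σᴺ (30 + y)) ≡ 30 + y
  σ-retraction-path y y≤ with mirror y in my
  ... | zero  = cong (30 +_) (trans (sym (cong mirror my)) (mirror-involutive y≤))
  ... | suc m = trans (cong (λ b → if b then 25 else σᴺ (30 + m)) (¬T⇒false (λ eq → <-irrefl (T-≡ᵇ eq) m<top)))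
                      (cong (29 +_) m-mirror)
    where
    m<top : m < p + q
    m<top = subst (_≤ p + q) my (mirror-≤ y)
    m-mirror : mirror m ≡ suc y
    m-mirror = begin
      mirror m                 ≡⟨ +-∸-assoc 1 m<top ⟩
      suc (mirror (suc m))     ≡⟨ cong (suc ∘ mirror) (sym my) ⟩
      suc (mirror (mirror y))  ≡⟨ cong suc (mirror-involutive y≤) ⟩
      suc y                    ∎
      where open ≡-Reasoning

  σ-retraction : ∀ x → x < nD → σ⁻¹ᴺ (σᴺ x) ≡ x
  σ-retraction x x<D with view x x<D
  ... | path {y} py = σ-retraction-path y (path-offset py)
  ... | gadget x x<30 with x ≟ 25
  ...   | yes refl = cong (λ b → if b then 25 else σᴺ hubExit) (≡ᵇ-refl (mirror 0))
  ...   | no  x≢25 = T-≡ᵇ (off-hub-check (λ x → σ⁻¹ᴺ (σᴺ x) ≡ᵇ x) tt x x<30 x≢25)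

  σ-injective : ∀ x y → x < nD → y < nD → σᴺ x ≡ σᴺ y → x ≡ y
  σ-injective x y x<D y<D eq = begin
    x              ≡⟨ sym (σ-retraction x x<D) ⟩
    σ⁻¹ᴺ (σᴺ x)    ≡⟨ cong σ⁻¹ᴺ eq ⟩
    σ⁻¹ᴺ (σᴺ y)    ≡⟨ σ-retraction y y<D ⟩
    y              ∎
    where open ≡-Reasoning

  σ-keeps-tail : ∀ x → x < nD → tailᴺ (σᴺ x) ≡ tailᴺ x
  σ-keeps-tail x x<D with view x x<D
  ... | gadget x x<30 with x ≟ 25
  ...   | yes refl = tail-outward z≤n
  ...   | no  x≢25 = gadget-σ-tail x x<30 x≢25
  σ-keeps-tail x x<D | path (inward j j≤q) with m≤n⇒m<n∨m≡n j≤q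
  ... | inj₁ j<q  = trans (cong tailᴺ (σ-inward j<q)) (trans (tail-outward j<q) (sym (tail-inward j≤q)))
  ... | inj₂ refl = cong tailᴺ σ-leaf
  σ-keeps-tail x x<D | path (outward zero    j≤q) = trans (cong tailᴺ σ-hubExit) (sym (tail-outward j≤q))
  σ-keeps-tail x x<D | path (outward (suc j) j<q) =
    trans (cong tailᴺ (σ-outward j<q)) (trans (tail-inward (<⇒≤ j<q)) (sym (tail-outward j<q)))

  hub-darts : ∀ x → x < nD → tailᴺ x ≡ 4 → x ≡ 25 ⊎ x ≡ 29 ⊎ x ≡ hubExit
  hub-darts x x<D at-hub with view x x<D
  ... | gadget x x<30 with gadget-at-hub x x<30 at-hub
  ...   | inj₁ x≡25 = inj₁ x≡25
  ...   | inj₂ x≡29 = inj₂ (inj₁ x≡29)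
  hub-darts x x<D at-hub | path (inward j j≤q) with trans (sym (tail-inward j≤q)) at-hub
  ... | ()
  hub-darts x x<D at-hub | path (outward zero j≤q) = inj₂ (inj₂ refl)
  hub-darts x x<D at-hub | path (outward (suc j) j≤q) with trans (sym (tail-outward j≤q)) at-hub
  ... | ()

  around-hub : ∀ {x y} → x ≡ 25 ⊎ x ≡ 29 ⊎ x ≡ hubExit → y ≡ 25 ⊎ y ≡ 29 ⊎ y ≡ hubExit → ∃ λ k → iter σᴺ k x ≡ y
  around-hub (inj₁ refl)        (inj₁ refl)        = 0 , refl
  around-hub (inj₁ refl)        (inj₂ (inj₁ refl)) = 2 , σ-hubExit
  around-hub (inj₁ refl)        (inj₂ (inj₂ refl)) = 1 , refl
  around-hub (inj₂ (inj₁ refl)) (inj₁ refl)        = 1 , refl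
  around-hub (inj₂ (inj₁ refl)) (inj₂ (inj₁ refl)) = 0 , refl
  around-hub (inj₂ (inj₁ refl)) (inj₂ (inj₂ refl)) = 2 , refl
  around-hub (inj₂ (inj₂ refl)) (inj₁ refl)        = 2 , cong σᴺ σ-hubExit
  around-hub (inj₂ (inj₂ refl)) (inj₂ (inj₁ refl)) = 1 , σ-hubExit
  around-hub (inj₂ (inj₂ refl)) (inj₂ (inj₂ refl)) = 0 , refl

  path-tail-off-hub : ∀ {y} → PathDart y → tailᴺ (30 + y) ≢ 4 → 9 ≤ tailᴺ (30 + y)
  path-tail-off-hub (inward  j j≤q)       _      = subst (9 ≤_) (sym (tail-inward j≤q)) (m≤m+n 9 j)
  path-tail-off-hub (outward zero j≤q)    off    = ⊥-elim (off (tail-outward j≤q))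
  path-tail-off-hub (outward (suc j) j≤q) _      = subst (9 ≤_) (sym (tail-outward j≤q)) (m≤m+n 9 j)

  gadget-path-apart : ∀ {x y} → x < 30 → PathDart y → tailᴺ x ≡ tailᴺ (30 + y) → tailᴺ x ≢ 4 → ⊥
  gadget-path-apart x<30 py same off =
    <-irrefl refl (<-≤-trans (gadget-tail-bound _ x<30) (subst (9 ≤_) (sym same) (path-tail-off-hub py (λ at → off (trans same at)))))

  -- Away from the hub, darts with the same tail are joined by the rotation:
  -- by inspection in the gadget, and because path vertex 9 + j carries only
  -- inward dart j and outward dart j + 1.
  off-hub-transitive : ∀ {x y} → DartView x → DartView y → tailᴺ x ≡ tailᴺ y → tailᴺ x ≢ 4 → ∃ λ k → iter σᴺ k x ≡ y
  off-hub-transitive (gadget x x<30) (gadget y y<30) same off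
    with to T-∨ (pair-check (λ x y → not (tailᴺ x ≡ᵇ tailᴺ y) ∨ ((tailᴺ x ≡ᵇ 4) ∨ any (λ k → iter σᴺ k x ≡ᵇ y) (upTo 4))) tt x y x<30 y<30)
  ... | inj₁ differ = ⊥-elim (T-≢ᵇ differ same)
  ... | inj₂ rest with to T-∨ rest
  ...   | inj₁ at-hub = ⊥-elim (off (T-≡ᵇ at-hub))
  ...   | inj₂ found  = let (k , reaches) = Any.satisfied (any⁻ (λ k → iter σᴺ k x ≡ᵇ y) (upTo 4) found) in k , T-≡ᵇ reaches
  off-hub-transitive (gadget x x<30) (path py) same off = ⊥-elim (gadget-path-apart x<30 py same off)
  off-hub-transitive (path px) (gadget y y<30) same off = ⊥-elim (gadget-path-apart y<30 px (sym same) (λ at → off (trans same at)))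
  off-hub-transitive (path (inward i i≤q)) (path (inward j j≤q)) same off =
    0 , cong (30 +_) (+-cancelˡ-≡ 9 _ _ (trans (sym (tail-inward i≤q)) (trans same (tail-inward j≤q))))
  off-hub-transitive (path (inward i i≤q)) (path (outward zero j≤q)) same off = ⊥-elim (off (trans same (tail-outward j≤q)))
  off-hub-transitive (path (inward i i≤q)) (path (outward (suc j) j<q)) same off
    with +-cancelˡ-≡ 9 _ _ (trans (sym (tail-inward i≤q)) (trans same (tail-outward j<q)))
  ... | refl = 1 , σ-inward j<q
  off-hub-transitive (path (outward zero i≤q)) (path _) same off = ⊥-elim (off (tail-outward i≤q))
  off-hub-transitive (path (outward (suc i) i<q)) (path (inward j j≤q)) same off
    with +-cancelˡ-≡ 9 _ _ (trans (sym (tail-outward i<q)) (trans same (tail-inward j≤q)))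
  ... | refl = 1 , σ-outward i<q
  off-hub-transitive (path (outward (suc i) i<q)) (path (outward j j≤q)) same off
    with inner-injective {suc i} {j} (trans (sym (tail-outward i<q)) (trans same (tail-outward j≤q)))
  ... | refl = 0 , refl

  σ-transitive : ∀ x y → x < nD → y < nD → tailᴺ x ≡ tailᴺ y → ∃ λ k → iter σᴺ k x ≡ y
  σ-transitive x y x<D y<D same with tailᴺ x ≟ 4
  ... | yes at-hub = around-hub (hub-darts x x<D at-hub) (hub-darts y y<D (trans (sym same) at-hub))
  ... | no  off    = off-hub-transitive (view x x<D) (view y y<D) same off

  presentation : Presentation nV nD
  presentation = record
    { tailᴺ = tailᴺ ; αᴺ = αᴺ ; σᴺ = σᴺ
    ; tail-bound = tail-bound ; α-bound = α-bound ; σ-bound = σ-bound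
    ; α-involutive = α-involutive ; α-fixfree = α-fixfree
    ; σ-injective = σ-injective ; σ-keeps-tail = σ-keeps-tail ; σ-transitive = σ-transitive
    }

  open Presented presentation

  -- No loops: gadget edges by inspection, and path edge j joins inner j < 9 + j to 9 + j.
  loopless : ∀ x → x < nD → tailᴺ x ≢ headᴺ x
  loopless x x<D with view x x<D
  ... | gadget x x<30         = T-≢ᵇ (gadget-check (λ x → not (tailᴺ x ≡ᵇ headᴺ x)) tt x x<30)
  ... | path (inward  j j≤q) = λ loop → <-irrefl (sym (trans (sym (tail-inward j≤q)) (trans loop (head-inward j≤q)))) (inner-< j)
  ... | path (outward j j≤q) = λ loop → <-irrefl (trans (sym (tail-outward j≤q)) (trans loop (head-outward j≤q))) (inner-< j)

  crossed : ∀ i j → 9 + i ≡ inner j → inner i ≡ 9 + j → ⊥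
  crossed i j i~j j~i = <-irrefl refl (<-trans (subst (_< 9 + i) j~i (inner-< i)) (subst (_< 9 + j) (sym i~j) (inner-< j)))

  gadget-head-bound : ∀ x → x < 30 → headᴺ x < 9
  gadget-head-bound x x<30 = gadget-tail-bound (αᴺ x) (gadget-α-bound x x<30)

  path-leaves-gadget : ∀ {y} → PathDart y → 9 ≤ tailᴺ (30 + y) ⊎ 9 ≤ headᴺ (30 + y)
  path-leaves-gadget (inward  j j≤q) = inj₁ (subst (9 ≤_) (sym (tail-inward j≤q)) (m≤m+n 9 j))
  path-leaves-gadget (outward j j≤q) = inj₂ (subst (9 ≤_) (sym (head-outward j≤q)) (m≤m+n 9 j))

  gadget-path-parallel : ∀ {x y} → x < 30 → PathDart y → tailᴺ x ≡ tailᴺ (30 + y) → headᴺ x ≡ headᴺ (30 + y) → ⊥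
  gadget-path-parallel {x} x<30 py sameTail sameHead with path-leaves-gadget py
  ... | inj₁ far = <-irrefl refl (<-≤-trans (gadget-tail-bound x x<30) (subst (9 ≤_) (sym sameTail) far))
  ... | inj₂ far = <-irrefl refl (<-≤-trans (gadget-head-bound x x<30) (subst (9 ≤_) (sym sameHead) far))

  no-parallel : ∀ {x y} → DartView x → DartView y → tailᴺ x ≡ tailᴺ y → headᴺ x ≡ headᴺ y → x ≡ y
  no-parallel (gadget x x<30) (gadget y y<30) sameTail sameHead
    with to T-∨ (pair-check (λ x y → not ((tailᴺ x ≡ᵇ tailᴺ y) ∧ (headᴺ x ≡ᵇ headᴺ y)) ∨ (x ≡ᵇ y)) tt x y x<30 y<30)
  ... | inj₂ x≡y   = T-≡ᵇ x≡y
  ... | inj₁ apart = ⊥-elim (T-not-∧ apart (≡⇒≡ᵇ _ _ sameTail) (≡⇒≡ᵇ _ _ sameHead))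
  no-parallel (gadget x x<30) (path py) sameTail sameHead = ⊥-elim (gadget-path-parallel x<30 py sameTail sameHead)
  no-parallel (path px) (gadget y y<30) sameTail sameHead = ⊥-elim (gadget-path-parallel y<30 px (sym sameTail) (sym sameHead))
  no-parallel (path (inward i i≤q)) (path (inward j j≤q)) sameTail _ =
    cong (30 +_) (+-cancelˡ-≡ 9 _ _ (trans (sym (tail-inward i≤q)) (trans sameTail (tail-inward j≤q))))
  no-parallel (path (outward i i≤q)) (path (outward j j≤q)) _ sameHead =
    cong (λ k → 30 + mirror k) (+-cancelˡ-≡ 9 _ _ (trans (sym (head-outward i≤q)) (trans sameHead (head-outward j≤q))))
  no-parallel (path (inward i i≤q)) (path (outward j j≤q)) sameTail sameHead = ⊥-elim (crossed i j
    (trans (sym (tail-inward i≤q)) (trans sameTail (tail-outward j≤q)))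
    (trans (sym (head-inward i≤q)) (trans sameHead (head-outward j≤q))))
  no-parallel (path (outward i i≤q)) (path (inward j j≤q)) sameTail sameHead = ⊥-elim (crossed j i
    (trans (sym (tail-inward j≤q)) (trans (sym sameTail) (tail-outward i≤q)))
    (trans (sym (head-inward j≤q)) (trans (sym sameHead) (head-outward i≤q))))

  simple : Simple graph
  simple = simple-from-tables loopless (λ x y x<D y<D → no-parallel (view x x<D) (view y y<D))

  gadget-degree path-degree : ℕ → ℕ
  gadget-degree a = count (λ x → tailᴺ x ≡ᵇ a) 30
  path-degree   a = count (λ y → tailᴺ (30 + y) ≡ᵇ a) (p + p)

  degree-split : ∀ v → degree graph v ≡ gadget-degree (toℕ v) + path-degree (toℕ v)
  degree-split v = trans (degree-count v) (count-+ (λ x → tailᴺ x ≡ᵇ toℕ v) 30 (p + p))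

  gadget-degree-bound : ∀ a → a < 9 → gadget-degree a ≤ (if a ≡ᵇ 4 then 2 else 4)
  gadget-degree-bound a a<9 = ≤ᵇ⇒≤ _ _ (certified {9} (λ a → gadget-degree a ≤ᵇ (if a ≡ᵇ 4 then 2 else 4)) tt a a<9)

  gadget-degree-beyond : ∀ a → 9 ≤ a → gadget-degree a ≡ 0
  gadget-degree-beyond a 9≤a = count-none _ 30 (λ x x<30 at →
    <-irrefl refl (<-≤-trans (gadget-tail-bound x x<30) (subst (9 ≤_) (sym (T-≡ᵇ at)) 9≤a)))

  path-degree-off-hub : ∀ a → a < 9 → a ≢ 4 → path-degree a ≡ 0
  path-degree-off-hub a a<9 a≢4 = count-none _ (p + p) (λ y y< at → away (pathDart y y<) (T-≡ᵇ at))
    where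
    away : ∀ {y} → PathDart y → tailᴺ (30 + y) ≢ a
    away py at = <-irrefl refl (<-≤-trans a<9 (subst (9 ≤_) at (path-tail-off-hub py (λ at-hub → a≢4 (trans (sym at) at-hub)))))

  -- Each path vertex is the tail of one inward and at most one outward dart.
  path-degree-≤2 : ∀ a → path-degree a ≤ 2
  path-degree-≤2 a = subst (_≤ 2) (sym (count-+ (λ y → tailᴺ (30 + y) ≡ᵇ a) p p)) (+-mono-≤ inward-part outward-part)
    where
    inward-part : count (λ y → tailᴺ (30 + y) ≡ᵇ a) p ≤ 1
    inward-part = count-unique _ p (λ i j i<p j<p at-i at-j → +-cancelˡ-≡ 9 _ _
      (trans (sym (tail-inward (≤-pred i<p))) (trans (T-≡ᵇ at-i) (trans (sym (T-≡ᵇ at-j)) (tail-inward (≤-pred j<p))))))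
    outward-tail : ∀ z → z < p → tailᴺ (30 + (p + z)) ≡ inner (q ∸ z)
    outward-tail z z<p = trans (cong (λ y → tailᴺ (30 + y)) (sym mirrored)) (tail-outward (m∸n≤m q z))
      where
      mirrored : mirror (q ∸ z) ≡ p + z
      mirrored = trans (mirror-inward (m∸n≤m q z)) (cong (p +_) (m∸[m∸n]≡n (≤-pred z<p)))
    outward-part : count (λ z → tailᴺ (30 + (p + z)) ≡ᵇ a) p ≤ 1
    outward-part = count-unique _ p (λ i j i<p j<p at-i at-j → begin
      i                ≡⟨ sym (m∸[m∸n]≡n (≤-pred i<p)) ⟩
      q ∸ (q ∸ i)      ≡⟨ cong (q ∸_) (inner-injective {q ∸ i} {q ∸ j} (trans (sym (outward-tail i i<p)) (trans (T-≡ᵇ at-i)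
                            (trans (sym (T-≡ᵇ at-j)) (outward-tail j j<p))))) ⟩
      q ∸ (q ∸ j)      ≡⟨ m∸[m∸n]≡n (≤-pred j<p) ⟩
      j                ∎)
      where open ≡-Reasoning

  -- Every vertex has degree at most 4: gadget vertices other than the hub get no
  -- path darts, the hub has 2 + 2, and path vertices have at most 2.
  degree-bound : ∀ a → gadget-degree a + path-degree a ≤ 4
  degree-bound a with a <? 9
  ... | no  a≮9 = subst (λ g → g + path-degree a ≤ 4) (sym (gadget-degree-beyond a (≮⇒≥ a≮9)))
                    (≤-trans (path-degree-≤2 a) (m≤m+n 2 2))
  ... | yes a<9 with a ≟ 4
  ...   | yes refl = +-mono-≤ (gadget-degree-bound 4 a<9) (path-degree-≤2 4)
  ...   | no  a≢4  = subst (λ t → gadget-degree a + t ≤ 4) (sym (path-degree-off-hub a a<9 a≢4))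
                      (subst (_≤ 4) (sym (+-identityʳ _))
                        (subst (λ b → gadget-degree a ≤ (if b then 2 else 4)) (¬T⇒false (a≢4 ∘ T-≡ᵇ)) (gadget-degree-bound a a<9)))

  -- Vertex 0 has four gadget darts and no path dart.
  max-degree : MaxDegree graph 4
  max-degree = (λ v → subst (_≤ 4) (sym (degree-split v)) (degree-bound (toℕ v)))
             , (fzero , trans (degree-split fzero) (cong (4 +_) (path-degree-off-hub 0 z<s (λ ()))))

  -- Faces are intervals of gadget darts [s, faceEnd₀ s); the outer face starting at 26
  -- also contains every path dart.
  faceStart : ℕ → Bool
  faceStart x = (x <ᵇ 30) ∧ (0 <ᵇ faceEnd₀ x)

  inFace : ℕ → ℕ → Bool
  inFace s e = (s ≤ᵇ e) ∧ (e <ᵇ faceEnd₀ s)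

  descent : ∀ x → x < nD → ¬ T (faceStart x) → φᴺ x < x
  descent x x<D not-start with view x x<D
  ... | path {y} py = subst (_< 30 + y) (sym (φ-path (path-offset py))) (n<1+n (29 + y))
  ... | gadget x x<30 with to T-∨ (gadget-check (λ x → faceStart x ∨ (φᴺ x <ᵇ x)) tt x x<30)
  ...   | inj₁ start   = ⊥-elim (not-start start)
  ...   | inj₂ descend = T-<ᵇ descend

  start-gadget : ∀ s → T (faceStart s) → s < 30
  start-gadget s start = T-<ᵇ (proj₁ (to (T-∧ {s <ᵇ 30}) start))

  -- The interval faces are closed under φ (by inspection), and so is the outer
  -- face, because φ only decreases path darts down to 29.
  inner-face-closed : ∀ s e → T (faceStart s) → s ≢ 26 → T (inFace s e) → T (inFace s (φᴺ e))
  inner-face-closed s e start s≢26 in-face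
    with to T-∨ (pair-check (λ s e → not (faceStart s) ∨ ((s ≡ᵇ 26) ∨ (not (inFace s e) ∨ inFace s (φᴺ e)))) tt s e
                   (start-gadget s start) e<30)
    where
    e<30 : e < 30
    e<30 = <-≤-trans (T-<ᵇ (proj₂ (to (T-∧ {s ≤ᵇ e}) in-face)))
             (≤ᵇ⇒≤ (faceEnd₀ s) 30 (gadget-check (λ s → faceEnd₀ s ≤ᵇ 30) tt s (start-gadget s start)))
  ... | inj₁ not-start = ⊥-elim (T-not not-start start)
  ... | inj₂ rest with to T-∨ rest
  ...   | inj₁ s≡26 = ⊥-elim (s≢26 (T-≡ᵇ s≡26))
  ...   | inj₂ rest′ with to T-∨ rest′
  ...     | inj₁ outside = ⊥-elim (T-not outside in-face)
  ...     | inj₂ closed  = closed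

  outer-face-closed : ∀ e → e < nD → 26 ≤ e → 26 ≤ φᴺ e
  outer-face-closed e e<D 26≤e with view e e<D
  ... | path {y} py = subst (26 ≤_) (sym (φ-path (path-offset py))) (≤-trans (m≤m+n 26 3) (m≤m+n 29 y))
  ... | gadget e e<30 with to T-∨ (gadget-check (λ e → (e <ᵇ 26) ∨ (26 ≤ᵇ φᴺ e)) tt e e<30)
  ...   | inj₁ e<26 = ⊥-elim (<-irrefl refl (<-≤-trans (T-<ᵇ e<26) 26≤e))
  ...   | inj₂ after = ≤ᵇ⇒≤ 26 (φᴺ e) after

  -- Every face start s is the least dart of its face: the outer face consists of
  -- the darts from 26 on, the others are intervals [s, faceEnd₀ s).
  face-of : ∀ s → s < nD → T (faceStart s) → Σ (ℕ → Set) λ Face →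
            Face s × (∀ e → e < nD → Face e → Face (φᴺ e)) × (∀ e → Face e → s ≤ e)
  face-of s s<D started with s ≟ 26
  ... | yes refl = (26 ≤_) , ≤-refl , outer-face-closed , (λ e 26≤e → 26≤e)
  ... | no  s≢26 = (T ∘ inFace s) , own-face , (λ e _ → inner-face-closed s e started s≢26)
                   , (λ e in-face → ≤ᵇ⇒≤ s e (proj₁ (to (T-∧ {s ≤ᵇ e}) in-face)))
    where
    own-face : T (inFace s s)
    own-face with to T-∨ (gadget-check (λ s → not (faceStart s) ∨ inFace s s) tt s (start-gadget s started))
    ... | inj₁ not-start = ⊥-elim (T-not not-start started)
    ... | inj₂ own       = own

  eight-faces : numFaces graph ≡ 8
  eight-faces = begin
    numFaces graph                                        ≡⟨ count-faces faceStart descent face-of ⟩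
    count faceStart (30 + (p + p))                        ≡⟨ count-+ faceStart 30 (p + p) ⟩
    8 + count (λ y → faceStart (30 + y)) (p + p)          ≡⟨ cong (8 +_) (count-none (λ y → faceStart (30 + y)) (p + p) (λ _ _ ())) ⟩
    8 + 0                                                 ∎
    where open ≡-Reasoning

  -- Euler's formula: 9 + p vertices, 9 + p + 6 edges, 8 faces.
  planar : Planar graph
  planar = trans (cong (λ f → 2 * nV + 2 * f) eight-faces) (euler p)
    where
    open +-*-Solver
    euler : ∀ m → 2 * (9 + m) + 2 * 8 ≡ (30 + (m + m)) + 4
    euler = solve 1 (λ m → con 2 :* (con 9 :+ m) :+ con 2 :* con 8 := (con 30 :+ (m :+ m)) :+ con 4) refl

  -- Every vertex is linked to the hub 4: gadget vertices along explicit gadget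
  -- darts, path vertex 9 + j along its inward dart to inner j.
  hop : ∀ x {b} → T (x <ᵇ 30) → Linked (headᴺ x) b → Linked (tailᴺ x) b
  hop x x<30 = step x (gadget-dart (T-<ᵇ x<30))

  gadget-to-hub : ∀ a → a < 9 → Linked a 4
  gadget-to-hub 0 _ = hop 10 tt (hop 22 tt here)
  gadget-to-hub 1 _ = hop 21 tt (hop 23 tt (hop 22 tt here))
  gadget-to-hub 2 _ = hop 0 tt (hop 10 tt (hop 22 tt here))
  gadget-to-hub 3 _ = hop 4 tt (hop 26 tt here)
  gadget-to-hub 4 _ = here
  gadget-to-hub 5 _ = hop 22 tt here
  gadget-to-hub 6 _ = hop 26 tt here
  gadget-to-hub 7 _ = hop 23 tt (hop 22 tt here)
  gadget-to-hub 8 _ = hop 15 tt (hop 23 tt (hop 22 tt here))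
  gadget-to-hub (suc (suc (suc (suc (suc (suc (suc (suc (suc a))))))))) (s≤s (s≤s (s≤s (s≤s (s≤s (s≤s (s≤s (s≤s (s≤s ())))))))))

  path-to-hub : ∀ j → j ≤ q → Linked (9 + j) 4
  path-to-hub j j≤q = subst (λ a → Linked a 4) (tail-inward j≤q)
    (step (30 + j) (path-dart (on-path j≤q)) (subst (λ a → Linked a 4) (sym (head-inward j≤q)) (towards j j≤q)))
    where
    towards : ∀ j → j ≤ q → Linked (inner j) 4
    towards zero    _   = here
    towards (suc j) j<q = path-to-hub j (<⇒≤ j<q)

  connected : Connected graph
  connected = connected-via (fromℕ< (gadget-vertex {4} (<ᵇ⇒< 4 9 tt))) to-hub
    where
    to-hub : ∀ a → a < nV → Linked a 4
    to-hub a a<n with a <? 9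
    ... | yes a<9 = gadget-to-hub a a<9
    ... | no  a≮9 = subst (λ b → Linked b 4) (m+[n∸m]≡n (≮⇒≥ a≮9))
                      (path-to-hub (a ∸ 9) (≤-pred (+-cancelˡ-< 9 _ _ (subst (_< nV) (sym (m+[n∸m]≡n (≮⇒≥ a≮9))) a<n))))

  -- The obstruction: seventeen gadget darts whose walks are facial P3s with no
  -- admissible colouring (they live around the vertices 0 … 8 and avoid the
  -- two P3s through the hub that the pendant path destroys).
  obstruction : List ℕ
  obstruction = 18 ∷ 23 ∷ 29 ∷ 6 ∷ 25 ∷ 17 ∷ 15 ∷ 5 ∷ 24 ∷ 27 ∷ 3 ∷ 8 ∷ 21 ∷ 1 ∷ 19 ∷ 14 ∷ 28 ∷ []

  walk : ℕ → Triple
  walk x = tailᴺ x , headᴺ x , headᴺ (φᴺ x)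

  FacialDart : ℕ → Set
  FacialDart x = x < 30 × tailᴺ x ≢ headᴺ x × headᴺ x ≢ headᴺ (φᴺ x) × tailᴺ x ≢ headᴺ (φᴺ x)

  facialDart? : ∀ x → Dec (FacialDart x)
  facialDart? x = x <? 30 ×-dec ¬? (tailᴺ x ≟ headᴺ x) ×-dec ¬? (headᴺ x ≟ headᴺ (φᴺ x)) ×-dec ¬? (tailᴺ x ≟ headᴺ (φᴺ x))

  obstruction-facial : All FacialDart obstruction
  obstruction-facial = toWitness {a? = All.all? facialDart? obstruction} tt

  obstruction-uncolourable : ∀ c → ¬ All (Respects c) (map walk obstruction)
  obstruction-uncolourable = no-respecting-colouring (map walk obstruction) 9 tt

  no-worm : ¬ Σ (Fin nV → ℕ) (FacialWORM33 graph)
  no-worm (c , worm) = obstruction-uncolourable (colourOf c)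
    (map⁺ {f = walk} (All.map (λ (x<30 , ≢₁ , ≢₂ , ≢₃) → worm-respects c worm _ (gadget-dart x<30) ≢₁ ≢₂ ≢₃) obstruction-facial))

  uncolourable : Uncolourable nV
  uncolourable = graph , simple , connected , planar , max-degree , no-worm

theorem3 : ∀ (n : ℕ) → n ≥ 18 →
    Σ (PlaneGraph n) λ G → Simple G × Connected G × Planar G × MaxDegree G 4
    × ¬ (Σ (Fin n → ℕ) λ c → FacialWORM33 G c)
theorem3 n n≥18 = subst Uncolourable (m+[n∸m]≡n 10≤n) (PendantPath.uncolourable (n ∸ 10))
  where
  10≤n : 10 ≤ n
  10≤n = ≤-trans (≤ᵇ⇒≤ 10 18 tt) n≥18
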